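{- Let $u\in S_n$ and let $D$ be a pipe dream for $u$. Suppose there exist $i,j$ with $(i,j)\notin D$ and $(i,j+1)\in D$. Let $i$ be maximal such that such a $j$ exists, and then let $j$ be maximal with $(i,j)\notin D$ and $(i,j+1)\in D$. Let $k>j$ be minimal with $(i,k+1)\notin D$. Then one can perform the inverse ladder moves $L^{ -1}_{i,j+1},L^{ -1}_{i,j+2},\dots,L^{ -1}_{i,k}$, in this order, starting from $D$. That is, each move is defined on the result of the preceding ones.
   Context: Let $\Delta_n=\{(i,j)\in[n]\times[n]: i+j\le n+1\}$, with matrix indexing (row $i$, column $j$). For $D\subseteq\Delta_n$, place a cross tile at each position of $D$ and an elbow tile at each position of $\Delta_n\setminus D$. This creates pipes connecting the top boundary with the left boundary. Label the pipes entering the top boundary $1,\dots,n$ from left to right. $D$ is a (reduced) pipe dream for $u\in S_n$ if no two pipes cross more than once and the labels of the pipes exiting the left edge, read from top to bottom, form $u$ in one-line notation. Ladder move: $L_{i,j}(D)=(D\setminus\{(i,j)\})\cup\{(i-m,j+1)\}$. It is defined when (a) $(i,j)\in D$ and $(i,j+1)\notin D$; (b) $(i-m,j),(i-m,j+1)\notin D$ for some $0<m<i$; and (c) $(i-k',j),(i-k',j+1)\in D$ for all $1\le k'<m$. Inverse ladder move: $L^{ -1}_{r,s}$ undoes this. It is defined on $D$ when $(r,s)\in D$, $(r,s-1)\notin D$, and there is $m\ge1$ with $(r+k',s-1),(r+k',s)\in D$ for all $1\le k'<m$ and $(r+m,s-1),(r+m,s)\notin D$. In that case $L^{ -1}_{r,s}(D)=(D\setminus\{(r,s)\})\cup\{(r+m,s-1)\}$.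 Thus $L^{ -1}_{i-m,j+1}=(L_{i,j})^{ -1}$. -}

module Defs where

open import Data.Nat using (ℕ; zero; suc; _+_; _*_; _∸_; _≤_; _<_; _≡ᵇ_; _≤ᵇ_)
open import Data.Bool using (Bool; true; false; if_then_else_; _∧_; _∨_; not)
open import Data.Maybe using (Maybe; just; nothing)
open import Data.Product using (_×_; _,_; Σ)
open import Data.List using (List; []; _∷_; length; filter)
open import Data.Unit using (⊤)
open import Data.Fin using (Fin; toℕ)
open import Data.Fin.Permutation using (Permutation′; _⟨$⟩ʳ_; _⟨$⟩ˡ_)
open import Relation.Binary.PropositionalEquality using (_≡_)
open import Relation.Nullary using (¬_)

-- A set of positions D ⊆ ℕ × ℕ (row i, column j), given by its
-- characteristic function: (i , j) ∈ D  iff  D i j ≡ true.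
Grid : Set
Grid = ℕ → ℕ → Bool

inΔ : ℕ → ℕ → ℕ → Set
inΔ n i j = 1 ≤ i × 1 ≤ j × i + j ≤ suc n

inΔᵇ : ℕ → ℕ → ℕ → Bool
inΔᵇ n i j = not (i ≡ᵇ 0) ∧ not (j ≡ᵇ 0) ∧ ((i + j) ≤ᵇ suc n)

SubsetΔ : ℕ → Grid → Set
SubsetΔ n D = ∀ i j → D i j ≡ true → inΔ n i j

-- Pipe tracing.  A pipe enters a tile either from the top or from the
-- right.  Cross: top→bottom, right→left.  Elbow: top→left, right→bottom.

data Dir : Set where
  fromTop fromRight : Dir

-- Result of tracing one pipe: the row at whose left edge it exits,
-- together with the list of cross tiles it passes through.
-- `nothing` means the pipe leaves Δ_n other than through the left edge
-- (or fuel ran out, which cannot happen with the fuel used below).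
trace : ℕ → Grid → ℕ → ℕ → ℕ → Dir → Maybe (ℕ × List (ℕ × ℕ))
trace n D zero i j d = nothing
trace n D (suc fuel) i j d with inΔᵇ n i j
... | false = nothing
... | true with D i j | d
...   | true  | fromTop   = addCross (trace n D fuel (suc i) j fromTop)
  where
  addCross : Maybe (ℕ × List (ℕ × ℕ)) → Maybe (ℕ × List (ℕ × ℕ))
  addCross nothing = nothing
  addCross (just (r , cs)) = just (r , ((i , j) ∷ cs))
...   | true  | fromRight = goLeft (i , j)
  where
  goLeft : ℕ × ℕ → Maybe (ℕ × List (ℕ × ℕ))
  goLeft (i , zero) = nothing
  goLeft (i , suc zero) = just (i , ((i , 1) ∷ []))
  goLeft (i , suc (suc j)) with trace n D fuel i (suc j) fromRight
  ... | nothing = nothing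
  ... | just (r , cs) = just (r , ((i , suc (suc j)) ∷ cs))
...   | false | fromTop   = goLeft j
  where
  goLeft : ℕ → Maybe (ℕ × List (ℕ × ℕ))
  goLeft zero = nothing
  goLeft (suc zero) = just (i , [])
  goLeft (suc (suc j)) = trace n D fuel i (suc j) fromRight
...   | false | fromRight = trace n D fuel (suc i) j fromTop

pipe : ℕ → Grid → ℕ → Maybe (ℕ × List (ℕ × ℕ))
pipe n D p = trace n D (suc (2 * n)) 1 p fromTop

elemᵇ : ℕ × ℕ → List (ℕ × ℕ) → Bool
elemᵇ c [] = false
elemᵇ (a , b) ((a' , b') ∷ cs) = ((a ≡ᵇ a') ∧ (b ≡ᵇ b')) ∨ elemᵇ (a , b) cs

common : List (ℕ × ℕ) → List (ℕ × ℕ) → ℕ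
common [] ys = 0
common (c ∷ xs) ys = if elemᵇ c ys then suc (common xs ys) else common xs ys

-- D is a (reduced) pipe dream for u ∈ S_n (u given in one-line notation
-- by u ⟨$⟩ʳ : rows → labels, 0-indexed via Fin):
--  * D ⊆ Δ_n;
--  * the pipe labelled p exits the left edge at row u⁻¹(p), i.e. the
--    labels read down the left edge give u;
--  * no two distinct pipes cross more than once.
IsPipeDream : (n : ℕ) → Permutation′ n → Grid → Set
IsPipeDream n u D =
  SubsetΔ n D ×
  (∀ (p : Fin n) → Σ (List (ℕ × ℕ)) λ cs →
      pipe n D (suc (toℕ p)) ≡ just (suc (toℕ (u ⟨$⟩ˡ p)) , cs)) ×
  (∀ (p q : Fin n) → ¬ (p ≡ q) → ∀ cp cq →
      pipe n D (suc (toℕ p)) ≡ just (suc (toℕ (u ⟨$⟩ˡ p)) , cp) →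
      pipe n D (suc (toℕ q)) ≡ just (suc (toℕ (u ⟨$⟩ˡ q)) , cq) →
      common cp cq ≤ 1)

InvLadderDefined : Grid → ℕ → ℕ → ℕ → Set
InvLadderDefined D r s m =
  D r s ≡ true × D r (s ∸ 1) ≡ false × 1 ≤ m ×
  (∀ k′ → 1 ≤ k′ → k′ < m → D (r + k′) (s ∸ 1) ≡ true × D (r + k′) s ≡ true) ×
  D (r + m) (s ∸ 1) ≡ false × D (r + m) s ≡ false

invLadder : Grid → ℕ → ℕ → ℕ → Grid
invLadder D r s m a b =
  if (a ≡ᵇ (r + m)) ∧ (b ≡ᵇ (s ∸ 1)) then true
  else if (a ≡ᵇ r) ∧ (b ≡ᵇ s) then false
  else D a b

Performable : Grid → ℕ → ℕ → ℕ → Set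
Performable D r s zero = ⊤
Performable D r s (suc t) =
  Σ ℕ λ m → InvLadderDefined D r s m × Performable (invLadder D r s m) r (suc s) t

GapBefore : Grid → ℕ → ℕ → Set
GapBefore D i j = 1 ≤ j × D i j ≡ false × D i (suc j) ≡ true

-- Below the maximal gap row i every row of D is left-closed: its crosses form an
-- initial segment of the row.  Fix a column c + 1 with j < c + 1 ≤ k and go down it
-- from the cross (i, c + 1) to the first elbow (i + m, c + 1).  The cells (i + k′, c)
-- above it are crosses by left-closedness, and (i + m, c) is an elbow, since
-- otherwise the two pipes entering (i, c + 1) would cross again at (i + m, j).  So
-- L⁻¹_{i,c+1} is defined with this m; as a move changes only the cell (i, c + 1) and
-- column c, the later moves of the run see the same cells as in D.
-- The two pipes are found by tracing backwards to the top edge, which never gets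
-- stuck because a pipe dream has no cross on the antidiagonal.

module Submission where

open import Defs
open import Data.Bool using (Bool; true; false; T)
open import Data.Bool.Properties using (∨-zeroʳ; ∧-zeroʳ)
open import Data.Empty using (⊥; ⊥-elim)
open import Data.Fin using (Fin; toℕ; fromℕ<)
open import Data.Fin.Permutation using (Permutation′; _⟨$⟩ˡ_)
open import Data.Fin.Properties using (toℕ-fromℕ<)
open import Data.List using (List; _∷_)
open import Data.List.Membership.Propositional using (_∈_)
open import Data.List.Relation.Binary.Subset.Propositional using (_⊆_)
open import Data.List.Relation.Unary.Any using (here; there)
open import Data.Maybe using (just)
open import Data.Nat
open import Data.Nat.Properties
open import Data.Product
open import Data.Sum using (inj₁; inj₂)
open import Data.Unit using (tt)
open import Function using (_∘_; id)
open import Relation.Binary.Construct.Closure.ReflexiveTransitive using (Star; ε; _◅_; _◅◅_)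
open import Relation.Binary.PropositionalEquality
open import Relation.Nullary using (¬_; contradiction)

true≢false : true ≢ false
true≢false ()

≡ᵇ-refl : ∀ m → (m ≡ᵇ m) ≡ true
≡ᵇ-refl zero = refl
≡ᵇ-refl (suc m) = ≡ᵇ-refl m

≢⇒≡ᵇ-false : ∀ {m n} → m ≢ n → (m ≡ᵇ n) ≡ false
≢⇒≡ᵇ-false {m} {n} m≢n with m ≡ᵇ n in eq
... | false = refl
... | true = contradiction (≡ᵇ⇒≡ m n (subst T (sym eq) tt)) m≢n

∈⇒elemᵇ : ∀ {x ys} → x ∈ ys → elemᵇ x ys ≡ true
∈⇒elemᵇ {a , b} (here refl) rewrite ≡ᵇ-refl a | ≡ᵇ-refl b = refl
∈⇒elemᵇ {a , b} {_ ∷ _} (there x∈ys) rewrite ∈⇒elemᵇ x∈ys = ∨-zeroʳ _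

common-∷ : ∀ c xs ys → common xs ys ≤ common (c ∷ xs) ys
common-∷ c xs ys with elemᵇ c ys
... | true = n≤1+n _
... | false = ≤-refl

∈-both⇒1≤common : ∀ {x xs ys} → x ∈ xs → x ∈ ys → 1 ≤ common xs ys
∈-both⇒1≤common {xs = _ ∷ _} (here refl) x∈ys rewrite ∈⇒elemᵇ x∈ys = s≤s z≤n
∈-both⇒1≤common {xs = c ∷ xs} {ys} (there x∈xs) x∈ys =
  ≤-trans (∈-both⇒1≤common x∈xs x∈ys) (common-∷ c xs ys)

∈-both⇒2≤common : ∀ {x x′ xs ys} → x ∈ xs → x′ ∈ xs → x ≢ x′ → x ∈ ys → x′ ∈ ys →
                  2 ≤ common xs ys
∈-both⇒2≤common (here refl) (here refl) x≢x′ _ _ = contradiction refl x≢x′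
∈-both⇒2≤common (here refl) (there x′∈xs) _ x∈ys x′∈ys
  rewrite ∈⇒elemᵇ x∈ys = s≤s (∈-both⇒1≤common x′∈xs x′∈ys)
∈-both⇒2≤common (there x∈xs) (here refl) _ x∈ys x′∈ys
  rewrite ∈⇒elemᵇ x′∈ys = s≤s (∈-both⇒1≤common x∈xs x∈ys)
∈-both⇒2≤common {xs = c ∷ xs} {ys} (there x∈xs) (there x′∈xs) x≢x′ x∈ys x′∈ys =
  ≤-trans (∈-both⇒2≤common x∈xs x′∈xs x≢x′ x∈ys x′∈ys) (common-∷ c xs ys)

first-false : ∀ (P : ℕ → Bool) b → P b ≡ false →
              ∃ λ m → P m ≡ false × (∀ k → k < m → P k ≡ true)
first-false P b Pb with P 0 in P0
... | false = 0 , P0 , λ _ ()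
first-false P zero Pb | true = contradiction (trans (sym P0) Pb) true≢false
first-false P (suc b) Pb | true with first-false (P ∘ suc) b Pb
... | m , Pm , before = suc m , Pm , λ { zero _ → P0 ; (suc k) (s≤s k<m) → before k k<m }

-- InvLadderDefined E r (suc c) m unfolds to
-- E r (suc c) ≡ true × E r c ≡ false × LadderColumn E r c m.
LadderColumn : Grid → ℕ → ℕ → ℕ → Set
LadderColumn E r c m =
  1 ≤ m ×
  (∀ k′ → 1 ≤ k′ → k′ < m → E (r + k′) c ≡ true × E (r + k′) (suc c) ≡ true) ×
  E (r + m) c ≡ false × E (r + m) (suc c) ≡ false

LadderColumn-cong : ∀ {E E′ r c m} → (∀ a b → r < a → c ≤ b → E a b ≡ E′ a b) →
                    LadderColumn E r c m → LadderColumn E′ r c m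
LadderColumn-cong {E} {E′} {r} {c} agree (1≤m , strip , bottom , bottom′) =
  1≤m ,
  (λ k′ 1≤k′ k′<m → let (top , top′) = strip k′ 1≤k′ k′<m in
    moved (m<m+n _ 1≤k′) ≤-refl top , moved (m<m+n _ 1≤k′) (n≤1+n c) top′) ,
  moved (m<m+n _ 1≤m) ≤-refl bottom , moved (m<m+n _ 1≤m) (n≤1+n c) bottom′
  where
  moved : ∀ {a b v} → r < a → c ≤ b → E a b ≡ v → E′ a b ≡ v
  moved r<a c≤b eq = trans (sym (agree _ _ r<a c≤b)) eq

module _ {E : Grid} {r c m : ℕ} (1≤m : 1 ≤ m) where
  private
    r≢r+m : r ≢ r + m
    r≢r+m = <⇒≢ (m<m+n r 1≤m)

  invLadder-clears : invLadder E r (suc c) m r (suc c) ≡ false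
  invLadder-clears rewrite ≢⇒≡ᵇ-false r≢r+m | ≡ᵇ-refl r | ≡ᵇ-refl c = refl

  invLadder-row : ∀ {b} → b ≢ suc c → invLadder E r (suc c) m r b ≡ E r b
  invLadder-row b≢ rewrite ≢⇒≡ᵇ-false r≢r+m | ≡ᵇ-refl r | ≢⇒≡ᵇ-false b≢ = refl

invLadder-below : ∀ {E r c m a b} → r < a → c < b → invLadder E r (suc c) m a b ≡ E a b
invLadder-below {r = r} {c} {m} {a} {b} r<a c<b
  rewrite ≢⇒≡ᵇ-false (>⇒≢ c<b) | ∧-zeroʳ (a ≡ᵇ (r + m)) | ≢⇒≡ᵇ-false (>⇒≢ r<a) = refl

performable-run : ∀ E r c t → E r c ≡ false →
  (∀ c′ → c ≤ c′ → c′ < c + t → E r (suc c′) ≡ true × ∃ (LadderColumn E r c′)) →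
  Performable E r (suc c) t
performable-run E r c zero _ _ = tt
performable-run E r c (suc t) gap ladders with ladders c ≤-refl (m<m+n c z<s)
... | top , m , column@(1≤m , _) =
  m , (top , gap , column) ,
  performable-run (invLadder E r (suc c) m) r (suc c) t (invLadder-clears {E} {r} {c} 1≤m) ladders′
  where
  ladders′ : ∀ c′ → suc c ≤ c′ → c′ < suc c + t →
             invLadder E r (suc c) m r (suc c′) ≡ true × ∃ (LadderColumn (invLadder E r (suc c) m) r c′)
  ladders′ c′ c<c′ c′<c+t with ladders c′ (<⇒≤ c<c′) (subst (c′ <_) (sym (+-suc c t)) c′<c+t)
  ... | top′ , m′ , column′ =
    trans (invLadder-row {E} {r} 1≤m (>⇒≢ (s≤s c<c′))) top′ ,
    m′ , LadderColumn-cong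
           (λ a b r<a c′≤b → sym (invLadder-below {E} {r} {c} {m} r<a (<-≤-trans c<c′ c′≤b)))
           column′

left-closed-below : ∀ {D i x a b} → (∀ i′ j′ → GapBefore D i′ j′ → i′ ≤ i) → i < x →
                    1 ≤ a → a ≤′ b → D x b ≡ true → D x a ≡ true
left-closed-below _ _ _ ≤′-refl Dxb = Dxb
left-closed-below {D} {x = x} maximal i<x 1≤a (≤′-step {b} a≤′b) Dxb with D x b in Dxb′
... | true = left-closed-below maximal i<x 1≤a a≤′b Dxb′
... | false = contradiction (maximal x b (≤-trans 1≤a (≤′⇒≤ a≤′b) , Dxb′ , Dxb)) (<⇒≱ i<x)

module PipeTracing (n : ℕ) (D : Grid) where

  inΔᵇ⇒≤ : ∀ a b → inΔᵇ n a b ≡ true → a + b ≤ suc n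
  inΔᵇ⇒≤ (suc a) (suc b) inside = ≤ᵇ⇒≤ (suc a + suc b) (suc n) (subst T (sym inside) tt)

  Entry : Set
  Entry = ℕ × ℕ × Dir

  -- Leftward moves start in column ≥ 2: from column 1 a pipe leaves through the left edge.
  data Step : Entry → Entry → Set where
    cross-down : ∀ {i j} → D i j ≡ true → Step (i , j , fromTop) (suc i , j , fromTop)
    cross-left : ∀ {i j} → D i (suc (suc j)) ≡ true →
                 Step (i , suc (suc j) , fromRight) (i , suc j , fromRight)
    elbow-left : ∀ {i j} → D i (suc (suc j)) ≡ false →
                 Step (i , suc (suc j) , fromTop) (i , suc j , fromRight)
    elbow-down : ∀ {i j} → D i j ≡ false → Step (i , j , fromRight) (suc i , j , fromTop)

  Path : Entry → Entry → Set
  Path = Star Step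

  ReachesExit : Entry → ℕ → List (ℕ × ℕ) → Set
  ReachesExit (i , j , d) r cs =
    ∃₂ λ fuel cs′ → trace n D fuel i j d ≡ just (r , cs′) × cs′ ⊆ cs

  trace-step : ∀ fuel {i j d e r cs} → trace n D fuel i j d ≡ just (r , cs) →
               Step (i , j , d) e → ReachesExit e r cs
  trace-step (suc fuel) {i} {j} tr (cross-down Dij) with inΔᵇ n i j
  ... | true with D i j
  ...   | true with trace n D fuel (suc i) j fromTop in tr′ | tr
  ...     | just _ | refl = fuel , _ , tr′ , there
  trace-step (suc fuel) {i} {suc (suc j)} tr (cross-left _) with inΔᵇ n i (suc (suc j))
  ... | true with D i (suc (suc j))
  ...   | true with trace n D fuel i (suc j) fromRight in tr′ | tr
  ...     | just _ | refl = fuel , _ , tr′ , there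
  trace-step (suc fuel) {i} {suc (suc j)} tr (elbow-left _) with inΔᵇ n i (suc (suc j))
  ... | true with D i (suc (suc j))
  ...   | false = fuel , _ , tr , id
  trace-step (suc fuel) {i} {j} tr (elbow-down _) with inΔᵇ n i j
  ... | true with D i j
  ...   | false = fuel , _ , tr , id

  reachesExit-path : ∀ {e e′ r cs} → ReachesExit e r cs → Path e e′ → ReachesExit e′ r cs
  reachesExit-path reach ε = reach
  reachesExit-path (fuel , cs′ , tr , cs′⊆cs) (s ◅ path) with trace-step fuel tr s
  ... | fuel′ , cs″ , tr′ , cs″⊆cs′ = reachesExit-path (fuel′ , cs″ , tr′ , cs′⊆cs ∘ cs″⊆cs′) path

  trace-records-cross : ∀ fuel {i j d r cs} → trace n D fuel i j d ≡ just (r , cs) →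
                        D i j ≡ true → (i , j) ∈ cs
  trace-records-cross (suc fuel) {i} {j} {fromTop} tr _ with inΔᵇ n i j
  ... | true with D i j
  ...   | true with trace n D fuel (suc i) j fromTop | tr
  ...     | just _ | refl = here refl
  trace-records-cross (suc fuel) {i} {suc zero} {fromRight} tr _ with inΔᵇ n i 1
  ... | true with D i 1
  ...   | true with tr
  ...     | refl = here refl
  trace-records-cross (suc fuel) {i} {suc (suc j)} {fromRight} tr _ with inΔᵇ n i (suc (suc j))
  ... | true with D i (suc (suc j))
  ...   | true with trace n D fuel i (suc j) fromRight | tr
  ...     | just _ | refl = here refl
  trace-records-cross (suc fuel) {i} {zero} {fromRight} tr _ with inΔᵇ n i 0
  ... | true with D i 0
  ...   | true with tr
  ...     | ()

  trace-exits-leftEdge : ∀ fuel {i r cs} → trace n D fuel i 1 fromRight ≡ just (r , cs) →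
                         D i 1 ≡ true → r ≡ i
  trace-exits-leftEdge (suc fuel) {i} tr _ with inΔᵇ n i 1
  ... | true with D i 1
  ...   | true with tr
  ...     | refl = refl

  trace-row-≤ : ∀ fuel {i j d r cs} → trace n D fuel i j d ≡ just (r , cs) → i ≤ r
  trace-row-≤ (suc fuel) {i} {j} {fromTop} tr with inΔᵇ n i j
  ... | true with D i j
  ...   | true with trace n D fuel (suc i) j fromTop in tr′ | tr
  ...     | just _ | refl = ≤-trans (n≤1+n i) (trace-row-≤ fuel tr′)
  trace-row-≤ (suc fuel) {i} {suc zero} {fromTop} tr | true | false with tr
  ... | refl = ≤-refl
  trace-row-≤ (suc fuel) {i} {suc (suc j)} {fromTop} tr | true | false = trace-row-≤ fuel tr
  trace-row-≤ (suc fuel) {i} {zero} {fromTop} () | true | false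
  trace-row-≤ (suc fuel) {i} {j} {fromRight} tr with inΔᵇ n i j
  ... | true with D i j
  ...   | false = ≤-trans (n≤1+n i) (trace-row-≤ fuel tr)
  trace-row-≤ (suc fuel) {i} {suc zero} {fromRight} tr | true | true with tr
  ... | refl = ≤-refl
  trace-row-≤ (suc fuel) {i} {suc (suc j)} {fromRight} tr | true | true
    with trace n D fuel i (suc j) fromRight in tr′ | tr
  ... | just _ | refl = trace-row-≤ fuel tr′
  trace-row-≤ (suc fuel) {i} {zero} {fromRight} () | true | true

  trace-leaves-antidiagonal : ∀ fuel {i j p} → D i j ≡ true → i + j ≡ suc n →
                              trace n D fuel i j fromTop ≢ just p
  trace-leaves-antidiagonal (suc fuel) {i} {j} _ onDiag tr with inΔᵇ n i j
  ... | true with D i j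
  ...   | true with trace n D fuel (suc i) j fromTop in tr′ | tr
  ...     | just _ | refl = below fuel tr′
    where
    below : ∀ fuel {p} → trace n D fuel (suc i) j fromTop ≢ just p
    below (suc fuel) _ with inΔᵇ n (suc i) j in inside
    ... | true = <⇒≱ (≤-reflexive (cong suc (sym onDiag))) (inΔᵇ⇒≤ (suc i) j inside)

  reachesExit-cross : ∀ {i j d r cs} → ReachesExit (i , j , d) r cs → D i j ≡ true → (i , j) ∈ cs
  reachesExit-cross (fuel , _ , tr , ⊆cs) Dij = ⊆cs (trace-records-cross fuel tr Dij)

  reachesExit-leftEdge : ∀ {i r cs} → ReachesExit (i , 1 , fromRight) r cs → D i 1 ≡ true → r ≡ i
  reachesExit-leftEdge (fuel , _ , tr , _) = trace-exits-leftEdge fuel tr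

  reachesExit-row-≤ : ∀ {i j d r cs} → ReachesExit (i , j , d) r cs → i ≤ r
  reachesExit-row-≤ (fuel , _ , tr , _) = trace-row-≤ fuel tr

  reachesExit-antidiagonal : ∀ {i j r cs} → D i j ≡ true → i + j ≡ suc n →
                             ¬ ReachesExit (i , j , fromTop) r cs
  reachesExit-antidiagonal Dij onDiag (fuel , _ , tr , _) = trace-leaves-antidiagonal fuel Dij onDiag tr

  down-crosses : ∀ x {y} l → (∀ k′ → k′ < l → D (x + k′) y ≡ true) →
                 Path (x , y , fromTop) (x + l , y , fromTop)
  down-crosses x zero _ rewrite +-identityʳ x = ε
  down-crosses x (suc l) crossed rewrite +-suc x l =
    down-crosses x l (λ k′ k′<l → crossed k′ (m<n⇒m<1+n k′<l)) ◅◅ cross-down (crossed l ≤-refl) ◅ ε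

  left-crosses : ∀ {x a b} → 1 ≤ a → a ≤′ b → (∀ z → a < z → z ≤ b → D x z ≡ true) →
                 Path (x , b , fromRight) (x , a , fromRight)
  left-crosses _ ≤′-refl _ = ε
  left-crosses (s≤s z≤n) (≤′-step {zero} (≤′-reflexive ())) _
  left-crosses 1≤a (≤′-step {suc b} a≤′b) crossed =
    cross-left (crossed (suc (suc b)) (s≤s (≤′⇒≤ a≤′b)) ≤-refl) ◅
    left-crosses 1≤a a≤′b (λ z a<z z≤b → crossed z a<z (m≤n⇒m≤1+n z≤b))

  -- p is 0-based: the pipe labelled p + 1 enters the tile (1 , p + 1) from the top.
  Labelled : Entry → Set
  Labelled e = ∃ λ p → p < n × Path (1 , suc p , fromTop) e

  extend : ∀ {e e′} → Labelled e → Step e e′ → Labelled e′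
  extend (p , p<n , path) s = p , p<n , path ◅◅ s ◅ ε

  module _ {X : ℕ} (free : ∀ a b → a < X → a + b ≡ suc n → D a b ≡ false) where

    -- By induction on the distance g from the tile (x , y + 1) to the antidiagonal.
    labelled-fromRight : ∀ {x} → x < X → (∀ {y} → 1 ≤ y → x + y ≤ suc n → Labelled (x , y , fromTop)) →
                         ∀ y g → 1 ≤ y → x + y + g ≡ n → Labelled (x , y , fromRight)
    labelled-fromRight {x} x<X labelledTop (suc y) g _ eq with D x (suc (suc y)) in e
    ... | false = extend (labelledTop (s≤s z≤n) inside) (elbow-left e)
      where
      inside : x + suc (suc y) ≤ suc n
      inside = subst (_≤ suc n) (sym (+-suc x (suc y))) (s≤s (subst (x + suc y ≤_) eq (m≤m+n _ g)))
    labelled-fromRight {x} x<X _ (suc y) zero _ eq | true =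
      contradiction (trans (sym e) (free x (suc (suc y)) x<X onDiag)) true≢false
      where
      onDiag : x + suc (suc y) ≡ suc n
      onDiag = trans (+-suc x (suc y)) (cong suc (trans (sym (+-identityʳ _)) eq))
    labelled-fromRight {x} x<X labelledTop (suc y) (suc g) _ eq | true =
      extend (labelled-fromRight x<X labelledTop (suc (suc y)) g (s≤s z≤n) eq′) (cross-left e)
      where
      eq′ : x + suc (suc y) + g ≡ n
      eq′ = trans (trans (cong (_+ g) (+-suc x (suc y))) (sym (+-suc (x + suc y) g))) eq

    labelled-fromTop : ∀ x y → x < X → 1 ≤ y → suc x + y ≤ suc n → Labelled (suc x , y , fromTop)
    labelled-fromTop zero (suc p) _ _ le = p , s≤s⁻¹ le , ε
    labelled-fromTop (suc x) y x<X 1≤y le with D (suc x) y in e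
    ... | true = extend (labelled-fromTop x y (<⇒≤ x<X) 1≤y (≤-trans (n≤1+n _) le)) (cross-down e)
    ... | false = extend (labelled-fromRight x<X (labelled-fromTop x _ (<⇒≤ x<X))
                                             y (n ∸ (suc x + y)) 1≤y (m+[n∸m]≡n (s≤s⁻¹ le)))
                         (elbow-down e)

module PipeDream {n : ℕ} {u : Permutation′ n} {D : Grid} (pd : IsPipeDream n u D) where
  open PipeTracing n D

  exitRow : Fin n → ℕ
  exitRow q = suc (toℕ (u ⟨$⟩ˡ q))

  record ThroughPipe (e : Entry) : Set where
    field
      label : Fin n
      crossings : List (ℕ × ℕ)
      isPipe : pipe n D (suc (toℕ label)) ≡ just (exitRow label , crossings)
      continues : ReachesExit e (exitRow label) crossings

  crosses-inΔ : SubsetΔ n D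
  crosses-inΔ = proj₁ pd

  labelled-through : ∀ {e} → Labelled e → ThroughPipe e
  labelled-through (p , p<n , path) with proj₁ (proj₂ pd) (fromℕ< p<n)
  ... | cs , isPipe = record
    { label = fromℕ< p<n
    ; crossings = cs
    ; isPipe = isPipe
    ; continues = reachesExit-path (suc (2 * n) , cs , isPipe , id)
                    (subst (λ p′ → Path (1 , suc p′ , fromTop) _) (sym (toℕ-fromℕ< p<n)) path)
    }

  -- A cross on the antidiagonal is entered from the top by a pipe traced back through
  -- the rows above it, and that pipe then leaves Δ downwards.
  no-antidiagonal-cross-above : ∀ X a b → a < X → a + b ≡ suc n → D a b ≡ false
  no-antidiagonal-cross-above (suc X) a b a≤X onDiag with D a b in Dab
  ... | false = refl
  ... | true with crosses-inΔ a b Dab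
  ...   | s≤s {_} {a′} z≤n , 1≤b , inside =
    ⊥-elim (reachesExit-antidiagonal Dab onDiag (ThroughPipe.continues (labelled-through
             (labelled-fromTop (no-antidiagonal-cross-above X) a′ b (s≤s⁻¹ a≤X) 1≤b inside))))

  no-antidiagonal-cross : ∀ {a b} → a + b ≡ suc n → D a b ≡ false
  no-antidiagonal-cross {a} {b} = no-antidiagonal-cross-above (suc a) a b ≤-refl

  cross-below-antidiagonal : ∀ {a b} → D a b ≡ true → a + b ≤ n
  cross-below-antidiagonal {a} {b} Dab =
    s≤s⁻¹ (≤∧≢⇒< (proj₂ (proj₂ (crosses-inΔ a b Dab)))
                  (λ onDiag → true≢false (trans (sym Dab) (no-antidiagonal-cross onDiag))))

  outside-Δ : ∀ {a b} → suc n < a + b → D a b ≡ false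
  outside-Δ {a} {b} outside with D a b in Dab
  ... | false = refl
  ... | true = contradiction (proj₂ (proj₂ (crosses-inΔ a b Dab))) (<⇒≱ outside)

  private
    antidiagonal-free : ∀ {X} a b → a < X → a + b ≡ suc n → D a b ≡ false
    antidiagonal-free _ _ _ = no-antidiagonal-cross

  through-top : ∀ {x y} → 1 ≤ x → 1 ≤ y → x + y ≤ suc n → ThroughPipe (x , y , fromTop)
  through-top {suc x} {y} _ 1≤y inside =
    labelled-through (labelled-fromTop antidiagonal-free x y ≤-refl 1≤y inside)

  through-right : ∀ {x y} → 1 ≤ x → 1 ≤ y → x + y ≤ n → ThroughPipe (x , y , fromRight)
  through-right {suc x} {y} _ 1≤y inside =
    labelled-through
      (labelled-fromRight {X = suc (suc x)} antidiagonal-free ≤-refl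
         (labelled-fromTop antidiagonal-free x _ (n≤1+n _))
         y (n ∸ (suc x + y)) 1≤y (m+[n∸m]≡n inside))

  -- The pipe entering (i, c+1) from the top runs down column c+1 to row i+m and then
  -- left along row i+m; the pipe entering it from the right runs left along row i to
  -- column j and then down column j past row i+m.  Both cross at (i, c+1) and (i+m, j).
  no-double-crossing : ∀ {i j c m} → 1 ≤ j → j ≤ c → 1 ≤ m →
    D i j ≡ false →
    (∀ z → j < z → z ≤ suc c → D i z ≡ true) →
    (∀ k′ → k′ < m → D (i + k′) (suc c) ≡ true) →
    D (i + m) (suc c) ≡ false →
    (∀ k′ → 1 ≤ k′ → k′ ≤ m → D (i + k′) j ≡ true) →
    (∀ z → 1 ≤ z → z ≤ c → D (i + m) z ≡ true) → ⊥
  no-double-crossing {c = zero} (s≤s _) () _ _ _ _ _ _ _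
  no-double-crossing {i} {j} {c@(suc _)} {m@(suc m′)} 1≤j j≤c _ Dij rowᵢ colᶜ Dcorner colʲ rowᵐ =
    contradiction (proj₂ (proj₂ pd) A.label B.label labels-differ A.crossings B.crossings A.isPipe B.isPipe)
                  (<⇒≱ (∈-both⇒2≤common inA₁ inA₂ corners-differ inB₁ inB₂))
    where
    Dᵢ : D i (suc c) ≡ true
    Dᵢ = rowᵢ (suc c) (s≤s j≤c) ≤-refl
    Dᵐ : D (i + m) j ≡ true
    Dᵐ = rowᵐ j 1≤j j≤c

    pipeA : ThroughPipe (i , suc c , fromTop)
    pipeA = let (1≤i , 1≤c , inside) = crosses-inΔ i (suc c) Dᵢ in through-top 1≤i 1≤c inside
    pipeB : ThroughPipe (i , suc c , fromRight)
    pipeB = let (1≤i , 1≤c , _) = crosses-inΔ i (suc c) Dᵢ in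
            through-right 1≤i 1≤c (cross-below-antidiagonal Dᵢ)
    module A = ThroughPipe pipeA
    module B = ThroughPipe pipeB

    A-at-corner : ReachesExit (i + m , j , fromRight) (exitRow A.label) A.crossings
    A-at-corner = reachesExit-path A.continues
      (down-crosses i m colᶜ ◅◅ elbow-left Dcorner ◅
       left-crosses 1≤j (≤⇒≤′ j≤c) (λ z j<z z≤c → rowᵐ z (≤-trans 1≤j (<⇒≤ j<z)) z≤c))
    A-exit : exitRow A.label ≡ i + m
    A-exit = reachesExit-leftEdge
      (reachesExit-path A-at-corner
         (left-crosses ≤-refl (≤⇒≤′ 1≤j) (λ z 1<z z≤j → rowᵐ z (<⇒≤ 1<z) (≤-trans z≤j j≤c))))
      (rowᵐ 1 ≤-refl (≤-trans 1≤j j≤c))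

    B-at-corner : ReachesExit (i + m , j , fromTop) (exitRow B.label) B.crossings
    B-at-corner =
      subst (λ a → ReachesExit (a , j , fromTop) (exitRow B.label) B.crossings) (sym (+-suc i m′))
      (reachesExit-path B.continues
        (left-crosses 1≤j (≤′-step (≤⇒≤′ j≤c)) rowᵢ ◅◅ elbow-down Dij ◅
         down-crosses (suc i) m′ (λ k′ k′<m′ → subst (λ a → D a j ≡ true) (+-suc i k′)
                                                  (colʲ (suc k′) (s≤s z≤n) (s≤s (<⇒≤ k′<m′))))))
    B-below : suc (i + m) ≤ exitRow B.label
    B-below = reachesExit-row-≤ (reachesExit-path B-at-corner (cross-down Dᵐ ◅ ε))

    labels-differ : A.label ≢ B.label
    labels-differ eq = 1+n≰n (≤-trans B-below (≤-reflexive (trans (cong exitRow (sym eq)) A-exit)))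
    corners-differ : (i , suc c) ≢ (i + m , j)
    corners-differ eq = <⇒≢ (m<m+n i z<s) (cong proj₁ eq)

    inA₁ : (i , suc c) ∈ A.crossings
    inA₁ = reachesExit-cross A.continues Dᵢ
    inA₂ : (i + m , j) ∈ A.crossings
    inA₂ = reachesExit-cross A-at-corner Dᵐ
    inB₁ : (i , suc c) ∈ B.crossings
    inB₁ = reachesExit-cross B.continues Dᵢ
    inB₂ : (i + m , j) ∈ B.crossings
    inB₂ = reachesExit-cross B-at-corner Dᵐ

  ladderColumn-below : ∀ {i j} → GapBefore D i j → (∀ i′ j′ → GapBefore D i′ j′ → i′ ≤ i) →
    ∀ c → j ≤ c → (∀ z → j < z → z ≤ suc c → D i z ≡ true) → ∃ (LadderColumn D i c)
  ladderColumn-below {i} {j} (1≤j , Dij , _) maximal c j≤c rowᵢ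
    with first-false (λ w → D (i + suc w) (suc c)) n
                     (outside-Δ (≤-<-trans (m≤n+m (suc n) i) (m<m+n (i + suc n) z<s)))
  ... | m′ , Dbottom , above = suc m′ , z<s , strip , Dcorner , Dbottom
    where
    colᶜ⁺ : ∀ k′ → k′ < suc m′ → D (i + k′) (suc c) ≡ true
    colᶜ⁺ zero _ = subst (λ a → D a (suc c) ≡ true) (sym (+-identityʳ i)) (rowᵢ (suc c) (s≤s j≤c) ≤-refl)
    colᶜ⁺ (suc k′) (s≤s k′<m′) = above k′ k′<m′

    left-closed : ∀ {k′ a b} → 1 ≤ k′ → 1 ≤ a → a ≤ b → D (i + k′) b ≡ true → D (i + k′) a ≡ true
    left-closed 1≤k′ 1≤a a≤b = left-closed-below maximal (m<m+n i 1≤k′) 1≤a (≤⇒≤′ a≤b)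

    strip : ∀ k′ → 1 ≤ k′ → k′ < suc m′ → D (i + k′) c ≡ true × D (i + k′) (suc c) ≡ true
    strip k′ 1≤k′ k′<m = left-closed 1≤k′ (≤-trans 1≤j j≤c) (n≤1+n c) (colᶜ⁺ k′ k′<m) , colᶜ⁺ k′ k′<m

    Dcorner : D (i + suc m′) c ≡ false
    Dcorner with D (i + suc m′) c in Dc
    ... | false = refl
    ... | true = ⊥-elim (no-double-crossing 1≤j j≤c z<s Dij rowᵢ colᶜ⁺ Dbottom colʲ rowᵐ)
      where
      rowᵐ : ∀ z → 1 ≤ z → z ≤ c → D (i + suc m′) z ≡ true
      rowᵐ z 1≤z z≤c = left-closed z<s 1≤z z≤c Dc
      colʲ : ∀ k′ → 1 ≤ k′ → k′ ≤ suc m′ → D (i + k′) j ≡ true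
      colʲ k′ 1≤k′ k′≤m with m≤n⇒m<n∨m≡n k′≤m
      ... | inj₁ k′<m = left-closed 1≤k′ 1≤j (m≤n⇒m≤1+n j≤c) (colᶜ⁺ k′ k′<m)
      ... | inj₂ refl = left-closed 1≤k′ 1≤j j≤c Dc

lemma3p3 : (n : ℕ) (u : Permutation′ n) (D : Grid) → IsPipeDream n u D →
    (i j k : ℕ) →
    GapBefore D i j →
    (∀ i′ j′ → GapBefore D i′ j′ → i′ ≤ i) →
    (∀ j′ → GapBefore D i j′ → j′ ≤ j) →
    j < k → D i (suc k) ≡ false →
    (∀ k′ → j < k′ → k′ < k → D i (suc k′) ≡ true) →
    Performable D i (suc j) (k ∸ j)
lemma3p3 n u D pd i j k gap maximal _ j<k _ crossedBeforeK =
  performable-run D i j (k ∸ j) (proj₁ (proj₂ gap)) ladders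
  where
  open PipeDream {n} {u} {D} pd

  rowᵢ : ∀ z → j < z → z ≤ k → D i z ≡ true
  rowᵢ (suc z) (s≤s j≤z) z<k with m≤n⇒m<n∨m≡n j≤z
  ... | inj₁ j<z = crossedBeforeK z j<z z<k
  ... | inj₂ refl = proj₂ (proj₂ gap)

  ladders : ∀ c → j ≤ c → c < j + (k ∸ j) → D i (suc c) ≡ true × ∃ (LadderColumn D i c)
  ladders c j≤c c<k′ =
    rowᵢ (suc c) (s≤s j≤c) c<k ,
    ladderColumn-below gap maximal c j≤c (λ z j<z z≤c → rowᵢ z j<z (≤-trans z≤c c<k))
    where
    c<k : c < k
    c<k = subst (c <_) (m+[n∸m]≡n (<⇒≤ j<k)) c<k′
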